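{- Let $n,g$ be integers with $0\leq g\leq \left\lfloor \frac{n-3}{2}\right\rfloor$, and let $G$ be a connected graph of order $n$. Then $\kappa_g(G)=2$ (i.e., $G$ has an $R_g$-cutset and the minimum size of one is $2$) if and only if $G$ satisfies one of the following conditions. (1) $\kappa(G)=2$ and there exists a vertex cut $\{u,v\}$ of $G$ such that each connected component of $G-\{u,v\}$ has at least $g+1$ vertices; (2) $\kappa(G)=1$, $g\geq 1$, and (a) for each cut vertex $u$ of $G$, some connected component of $G-u$ has at most $g$ vertices, and (b) either there exists a cut vertex $v$ such that $G-v$ has at least $3$ connected components, one of which consists of a single vertex and each of the others has at least $g+1$ vertices; or there are two vertices $x,y$, neither of which is a cut vertex of $G$, such that $G-\{x,y\}$ is not connected and each connected component of $G-\{x,y\}$ has at least $g+1$ vertices.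
   Context: $\kappa(G)$ is the vertex connectivity of $G$. A cut vertex is a vertex $v$ with $G-v$ disconnected; a vertex cut is a set $S$ with $G-S$ disconnected. A set $S$ of vertices is a cutset if $G-S$ is disconnected; for a non-negative integer $g$, a cutset is an $R_g$-cutset if every component of $G-S$ has at least $g+1$ vertices. If $G$ has an $R_g$-cutset, $\kappa_g(G)$ is the minimum cardinality of an $R_g$-cutset of $G$. -}

module Defs where

open import Data.Nat using (ℕ; zero; suc; _+_; _∸_; _≤_)
open import Data.Fin using (Fin)
open import Data.Fin.Subset using (Subset; _∈_; _∉_; ∣_∣; ⁅_⁆; _∪_; ⊥)
open import Data.Product using (Σ; ∃; ∃-syntax; _×_; _,_)
open import Data.Sum using (_⊎_)
open import Relation.Nullary using (¬_)
open import Relation.Binary using (Decidable)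
open import Relation.Binary.PropositionalEquality using (_≡_; _≢_)

record Graph (n : ℕ) : Set₁ where
  field
    Adj    : Fin n → Fin n → Set
    adj?   : Decidable Adj
    sym    : ∀ {x y} → Adj x y → Adj y x
    irrefl : ∀ {x} → ¬ Adj x x

module _ {n : ℕ} (G : Graph n) where
  open Graph G

  data Reach (S : Subset n) (x : Fin n) : Fin n → Set where
    here : x ∉ S → Reach S x x
    step : ∀ {y z} → Reach S x y → Adj y z → z ∉ S → Reach S x z

  Connected : Set
  Connected = ∀ x y → Reach ⊥ x y

  Disconnected : Subset n → Set
  Disconnected S = ∃[ x ] ∃[ y ] (x ∉ S × y ∉ S × ¬ Reach S x y)

  IsComponent : Subset n → Subset n → Set
  IsComponent S C =
    (∃[ x ] x ∈ C)
    × (∀ x → x ∈ C → x ∉ S)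
    × (∀ x y → x ∈ C → y ∈ C → Reach S x y)
    × (∀ x y → x ∈ C → Reach S x y → y ∈ C)

  AllComponentsAtLeast : ℕ → Subset n → Set
  AllComponentsAtLeast g S = ∀ C → IsComponent S C → suc g ≤ ∣ C ∣

  IsRgCutset : ℕ → Subset n → Set
  IsRgCutset g S = Disconnected S × AllComponentsAtLeast g S

  KappaG≡ : ℕ → ℕ → Set
  KappaG≡ g k = (∃[ S ] (IsRgCutset g S × ∣ S ∣ ≡ k))
              × (∀ S → IsRgCutset g S → k ≤ ∣ S ∣)

  Separating : Subset n → Set
  Separating S = Disconnected S ⊎ (n ∸ ∣ S ∣ ≤ 1)

  Kappa≡ : ℕ → Set
  Kappa≡ k = (∃[ S ] (Separating S × ∣ S ∣ ≡ k))
           × (∀ S → Separating S → k ≤ ∣ S ∣)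

  CutVertex : Fin n → Set
  CutVertex v = Disconnected ⁅ v ⁆

  Cond1 : ℕ → Set
  Cond1 g = Kappa≡ 2
          × ∃[ u ] ∃[ v ] (u ≢ v × Disconnected (⁅ u ⁆ ∪ ⁅ v ⁆)
                           × AllComponentsAtLeast g (⁅ u ⁆ ∪ ⁅ v ⁆))

  Cond2a : ℕ → Set
  Cond2a g = ∀ u → CutVertex u → ∃[ C ] (IsComponent ⁅ u ⁆ C × ∣ C ∣ ≤ g)

  Cond2b : ℕ → Set
  Cond2b g =
    (∃[ v ] (CutVertex v
      × ∃[ C₁ ] ∃[ C₂ ] ∃[ C₃ ]
          ( IsComponent ⁅ v ⁆ C₁ × IsComponent ⁅ v ⁆ C₂ × IsComponent ⁅ v ⁆ C₃
          × C₁ ≢ C₂ × C₁ ≢ C₃ × C₂ ≢ C₃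
          × ∣ C₁ ∣ ≡ 1
          × (∀ C → IsComponent ⁅ v ⁆ C → C ≢ C₁ → suc g ≤ ∣ C ∣))))
    ⊎ (∃[ x ] ∃[ y ] (x ≢ y × ¬ CutVertex x × ¬ CutVertex y
          × Disconnected (⁅ x ⁆ ∪ ⁅ y ⁆)
          × AllComponentsAtLeast g (⁅ x ⁆ ∪ ⁅ y ⁆)))

  Cond2 : ℕ → Set
  Cond2 g = Kappa≡ 1 × 1 ≤ g × Cond2a g × Cond2b g

-- If κ_g(G) = 2 is witnessed by {x, y} and G has no cut vertex, this is (1).
-- Otherwise minimality says that no cut vertex u is an R_g-cutset, so G − u has a
-- component with at most g vertices, which is (2)(a). If x is a cut vertex and C
-- such a small component of G − x, then y ∈ C (else C is a small component of
-- G − {x, y}) and C = {y} (else a component of G − {x, y} inside C − y is small):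
-- y is a pendant vertex at x, and the components of G − {x, y} are exactly the
-- components of G − x other than {y}. The same correspondence shows, conversely,
-- that a pendant vertex w at a cut vertex v makes {v, w} an R_g-cutset.
module Submission where

open import Defs
open import Data.Bool using (true; false)
open import Data.Bool.Properties using (T-≡)
open import Data.Empty using (⊥-elim)
open import Data.Fin using (Fin; zero; suc; _≟_)
open import Data.Fin.Properties using (any?; all?) renaming (suc-injective to Fin-suc-injective)
open import Data.Fin.Subset using (Subset; _∈_; _∉_; _⊆_; ∣_∣; ⁅_⁆; _∪_; ⊥)
open import Data.Fin.Subset.Properties
  using (_∈?_; x∈⁅x⁆; x∈⁅y⁆⇒x≡y; x≢y⇒x∉⁅y⁆; ∣⁅x⁆∣≡1; ∣⊥∣≡0; ∣p∣≤n; p⊆p∪q; q⊆p∪q; x∈p∪q⁻;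
         p⊆q⇒∣p∣≤∣q∣; p⊂q⇒∣p∣<∣q∣; ⊆-antisym; ∪-comm; ∪-identityˡ; anySubset?)
open import Data.Nat using (ℕ; zero; suc; _≤_; _<_; _+_; _∸_; _/_; z≤n; s≤s; _≤?_)
open import Data.Nat.Properties
  using (≤-trans; ≤-reflexive; m≤m+n; <⇒≤; <⇒≱; ≰⇒>; n≢0⇒n>0; +-suc; +-monoʳ-≤; n≤1+n; ≤-antisym)
  renaming (suc-injective to ℕ-suc-injective)
open import Data.Product using (∃-syntax; _×_; _,_; proj₁; proj₂)
open import Data.Sum using (_⊎_; inj₁; inj₂)
open import Data.Vec using (_∷_; []; tabulate)
open import Data.Vec.Properties using (lookup∘tabulate; lookup⇒[]=; []=⇒lookup)
open import Function using (_∘_)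
open import Function.Bundles using (_⇔_; mk⇔; Equivalence)
open import Relation.Nullary using (¬_; Dec; yes; no)
open import Relation.Nullary.Decidable as Dec using (isYes; ¬?; _×-dec_; _→-dec_; toWitness; fromWitness)
open import Relation.Binary.PropositionalEquality using (_≡_; _≢_; refl; sym; trans; cong; cong₂; subst; ≢-sym)

private variable
  n g : ℕ
  p q : Subset n
  x y : Fin n

x∈p⇒⁅x⁆⊆p : x ∈ p → ⁅ x ⁆ ⊆ p
x∈p⇒⁅x⁆⊆p {x = x} {p = p} x∈p y∈⁅x⁆ = subst (_∈ p) (sym (x∈⁅y⁆⇒x≡y x y∈⁅x⁆)) x∈p

x∈p⇒0<∣p∣ : x ∈ p → 0 < ∣ p ∣
x∈p⇒0<∣p∣ {x = x} x∈p = subst (_≤ _) (∣⁅x⁆∣≡1 x) (p⊆q⇒∣p∣≤∣q∣ (x∈p⇒⁅x⁆⊆p x∈p))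

x∉p⇒∣p∣<∣p∪⁅x⁆∣ : x ∉ p → ∣ p ∣ < ∣ p ∪ ⁅ x ⁆ ∣
x∉p⇒∣p∣<∣p∪⁅x⁆∣ {x = x} {p = p} x∉p =
  p⊂q⇒∣p∣<∣q∣ (p⊆p∪q ⁅ x ⁆ , x , q⊆p∪q p ⁅ x ⁆ (x∈⁅x⁆ x) , x∉p)

x∉p∧x≢y⇒x∉p∪⁅y⁆ : x ∉ p → x ≢ y → x ∉ p ∪ ⁅ y ⁆
x∉p∧x≢y⇒x∉p∪⁅y⁆ {p = p} {y = y} x∉p x≢y x∈p∪⁅y⁆ with x∈p∪q⁻ p ⁅ y ⁆ x∈p∪⁅y⁆
... | inj₁ x∈p = x∉p x∈p
... | inj₂ x∈⁅y⁆ = x≢y (x∈⁅y⁆⇒x≡y y x∈⁅y⁆)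

∣p∪q∣≤∣p∣+∣q∣ : (p q : Subset n) → ∣ p ∪ q ∣ ≤ ∣ p ∣ + ∣ q ∣
∣p∪q∣≤∣p∣+∣q∣ [] [] = z≤n
∣p∪q∣≤∣p∣+∣q∣ (true ∷ p) (true ∷ q) = s≤s (≤-trans (∣p∪q∣≤∣p∣+∣q∣ p q) (+-monoʳ-≤ ∣ p ∣ (n≤1+n ∣ q ∣)))
∣p∪q∣≤∣p∣+∣q∣ (true ∷ p) (false ∷ q) = s≤s (∣p∪q∣≤∣p∣+∣q∣ p q)
∣p∪q∣≤∣p∣+∣q∣ (false ∷ p) (true ∷ q) =
  ≤-trans (s≤s (∣p∪q∣≤∣p∣+∣q∣ p q)) (≤-reflexive (sym (+-suc ∣ p ∣ ∣ q ∣)))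
∣p∪q∣≤∣p∣+∣q∣ (false ∷ p) (false ∷ q) = ∣p∪q∣≤∣p∣+∣q∣ p q

x≢y⇒∣⁅x⁆∪⁅y⁆∣≡2 : x ≢ y → ∣ ⁅ x ⁆ ∪ ⁅ y ⁆ ∣ ≡ 2
x≢y⇒∣⁅x⁆∪⁅y⁆∣≡2 {x = x} {y = y} x≢y = ≤-antisym
  (≤-trans (∣p∪q∣≤∣p∣+∣q∣ ⁅ x ⁆ ⁅ y ⁆) (≤-reflexive (cong₂ _+_ (∣⁅x⁆∣≡1 x) (∣⁅x⁆∣≡1 y))))
  (subst (_< ∣ ⁅ x ⁆ ∪ ⁅ y ⁆ ∣) (∣⁅x⁆∣≡1 x) (x∉p⇒∣p∣<∣p∪⁅x⁆∣ (x≢y⇒x∉⁅y⁆ (≢-sym x≢y))))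

∣p∣≡0⇒p≡⊥ : (p : Subset n) → ∣ p ∣ ≡ 0 → p ≡ ⊥
∣p∣≡0⇒p≡⊥ [] _ = refl
∣p∣≡0⇒p≡⊥ (false ∷ p) ∣p∣≡0 = cong (false ∷_) (∣p∣≡0⇒p≡⊥ p ∣p∣≡0)

∣p∣≡1⇒p≡⁅x⁆ : (p : Subset n) → ∣ p ∣ ≡ 1 → ∃[ x ] p ≡ ⁅ x ⁆
∣p∣≡1⇒p≡⁅x⁆ (true ∷ p) ∣p∣≡1 = zero , cong (true ∷_) (∣p∣≡0⇒p≡⊥ p (ℕ-suc-injective ∣p∣≡1))
∣p∣≡1⇒p≡⁅x⁆ (false ∷ p) ∣p∣≡1 with ∣p∣≡1⇒p≡⁅x⁆ p ∣p∣≡1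
... | x , p≡⁅x⁆ = suc x , cong (false ∷_) p≡⁅x⁆

∣p∣≡2⇒p≡⁅x⁆∪⁅y⁆ : (p : Subset n) → ∣ p ∣ ≡ 2 → ∃[ x ] ∃[ y ] (x ≢ y × p ≡ ⁅ x ⁆ ∪ ⁅ y ⁆)
∣p∣≡2⇒p≡⁅x⁆∪⁅y⁆ (true ∷ p) ∣p∣≡2 with ∣p∣≡1⇒p≡⁅x⁆ p (ℕ-suc-injective ∣p∣≡2)
... | y , p≡⁅y⁆ = zero , suc y , (λ ()) , cong (true ∷_) (trans p≡⁅y⁆ (sym (∪-identityˡ ⁅ y ⁆)))
∣p∣≡2⇒p≡⁅x⁆∪⁅y⁆ (false ∷ p) ∣p∣≡2 with ∣p∣≡2⇒p≡⁅x⁆∪⁅y⁆ p ∣p∣≡2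
... | x , y , x≢y , p≡⁅x⁆∪⁅y⁆ = suc x , suc y , x≢y ∘ Fin-suc-injective , cong (false ∷_) p≡⁅x⁆∪⁅y⁆

p≢⊥⇒0<∣p∣ : p ≢ ⊥ → 0 < ∣ p ∣
p≢⊥⇒0<∣p∣ {p = p} p≢⊥ with ∣ p ∣ in ∣p∣≡k
... | zero = ⊥-elim (p≢⊥ (∣p∣≡0⇒p≡⊥ p ∣p∣≡k))
... | suc _ = s≤s z≤n

p≢⊥∧p≢⁅x⁆⇒1<∣p∣ : p ≢ ⊥ → (∀ x → p ≢ ⁅ x ⁆) → 1 < ∣ p ∣
p≢⊥∧p≢⁅x⁆⇒1<∣p∣ {p = p} p≢⊥ p≢⁅x⁆ with ∣ p ∣ in ∣p∣≡k
... | zero = ⊥-elim (p≢⊥ (∣p∣≡0⇒p≡⊥ p ∣p∣≡k))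
... | suc zero = ⊥-elim (p≢⁅x⁆ _ (proj₂ (∣p∣≡1⇒p≡⁅x⁆ p ∣p∣≡k)))
... | suc (suc _) = s≤s (s≤s z≤n)

3≤n⇒n∸k≰1 : ∀ {k} → 3 ≤ n → k ≤ 1 → ¬ (n ∸ k ≤ 1)
3≤n⇒n∸k≰1 (s≤s (s≤s (s≤s _))) z≤n (s≤s ())
3≤n⇒n∸k≰1 (s≤s (s≤s (s≤s _))) (s≤s z≤n) (s≤s ())

module _ {n : ℕ} (G : Graph n) where
  open Graph G renaming (sym to Adj-sym)

  private variable
    S T C D E : Subset n
    a b c v w : Fin n

  Reach-source∉ : Reach G S a b → a ∉ S
  Reach-source∉ (here a∉S) = a∉S
  Reach-source∉ (step r _ _) = Reach-source∉ r

  Reach-target∉ : Reach G S a b → b ∉ S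
  Reach-target∉ (here b∉S) = b∉S
  Reach-target∉ (step _ _ b∉S) = b∉S

  Reach-trans : Reach G S a b → Reach G S b c → Reach G S a c
  Reach-trans r (here _) = r
  Reach-trans r (step s e c∉S) = step (Reach-trans r s) e c∉S

  Reach-prepend : Adj a b → a ∉ S → Reach G S b c → Reach G S a c
  Reach-prepend e a∉S r = Reach-trans (step (here a∉S) e (Reach-source∉ r)) r

  Reach-sym : Reach G S a b → Reach G S b a
  Reach-sym (here a∉S) = here a∉S
  Reach-sym (step r e b∉S) = Reach-prepend (Adj-sym e) b∉S (Reach-sym r)

  Reach-antitone : S ⊆ T → Reach G T a b → Reach G S a b
  Reach-antitone S⊆T (here a∉T) = here (a∉T ∘ S⊆T)
  Reach-antitone S⊆T (step r e b∉T) = step (Reach-antitone S⊆T r) e (b∉T ∘ S⊆T)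

  FirstStep : Subset n → Fin n → Fin n → Set
  FirstStep S a b = ∃[ c ] (Adj a c × c ∉ S × Reach G (S ∪ ⁅ a ⁆) c b)

  -- Cut the walk after its last visit to its source.
  Reach-uncons : Reach G S a b → a ≡ b ⊎ FirstStep S a b
  Reach-uncons (here _) = inj₁ refl
  Reach-uncons {a = a} (step {z = b} r e b∉S) with b ≟ a
  ... | yes b≡a = inj₁ (sym b≡a)
  ... | no b≢a with Reach-uncons r
  ...   | inj₁ refl = inj₂ (b , e , b∉S , here (x∉p∧x≢y⇒x∉p∪⁅y⁆ b∉S b≢a))
  ...   | inj₂ (c , e′ , c∉S , r′) = inj₂ (c , e′ , c∉S , step r′ e (x∉p∧x≢y⇒x∉p∪⁅y⁆ b∉S b≢a))

  FirstStep⇔Reach : a ∉ S → a ≢ b → FirstStep S a b ⇔ Reach G S a b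
  FirstStep⇔Reach {a = a} {S = S} {b = b} a∉S a≢b = mk⇔ prepend uncons
    where
    prepend : FirstStep S a b → Reach G S a b
    prepend (c , e , _ , r) = Reach-prepend e a∉S (Reach-antitone (p⊆p∪q ⁅ a ⁆) r)
    uncons : Reach G S a b → FirstStep S a b
    uncons r with Reach-uncons r
    ... | inj₁ a≡b = ⊥-elim (a≢b a≡b)
    ... | inj₂ first = first

  -- k bounds the number of vertices outside S; each first step deletes its source.
  reach?-within : ∀ k S → n ≤ k + ∣ S ∣ → ∀ a b → Dec (Reach G S a b)
  reach?-within k S bound a b with a ∈? S | a ≟ b
  ... | yes a∈S | _ = no λ r → Reach-source∉ r a∈S
  ... | no a∉S | yes refl = yes (here a∉S)
  reach?-within zero S bound a b | no a∉S | no _ =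
    ⊥-elim (<⇒≱ (x∉p⇒∣p∣<∣p∪⁅x⁆∣ a∉S) (≤-trans (∣p∣≤n (S ∪ ⁅ a ⁆)) bound))
  reach?-within (suc k) S bound a b | no a∉S | no a≢b =
    Dec.map (FirstStep⇔Reach a∉S a≢b)
      (any? λ c → adj? a c ×-dec ¬? (c ∈? S) ×-dec reach?-within k (S ∪ ⁅ a ⁆) bound′ c b)
    where
    bound′ : n ≤ k + ∣ S ∪ ⁅ a ⁆ ∣
    bound′ = ≤-trans bound
      (≤-trans (≤-reflexive (sym (+-suc k ∣ S ∣))) (+-monoʳ-≤ k (x∉p⇒∣p∣<∣p∪⁅x⁆∣ a∉S)))

  reach? : ∀ S a b → Dec (Reach G S a b)
  reach? S = reach?-within n S (m≤m+n n ∣ S ∣)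

  componentOf : Subset n → Fin n → Subset n
  componentOf S a = tabulate (isYes ∘ reach? S a)

  ∈componentOf⁻ : b ∈ componentOf S a → Reach G S a b
  ∈componentOf⁻ {b = b} {S = S} {a = a} b∈ =
    toWitness (Equivalence.from T-≡
      (trans (sym (lookup∘tabulate (isYes ∘ reach? S a) b)) ([]=⇒lookup b∈)))

  ∈componentOf⁺ : Reach G S a b → b ∈ componentOf S a
  ∈componentOf⁺ {S = S} {a = a} {b = b} r = lookup⇒[]= b (componentOf S a)
    (trans (lookup∘tabulate (isYes ∘ reach? S a) b) (Equivalence.to T-≡ (fromWitness r)))

  a∈componentOf : a ∉ S → a ∈ componentOf S a
  a∈componentOf a∉S = ∈componentOf⁺ (here a∉S)

  componentOf-isComponent : a ∉ S → IsComponent G S (componentOf S a)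
  componentOf-isComponent a∉S =
    (_ , a∈componentOf a∉S)
    , (λ _ → Reach-target∉ ∘ ∈componentOf⁻)
    , (λ _ _ b∈ c∈ → Reach-trans (Reach-sym (∈componentOf⁻ b∈)) (∈componentOf⁻ c∈))
    , (λ _ _ b∈ r → ∈componentOf⁺ (Reach-trans (∈componentOf⁻ b∈) r))

  component-avoids : IsComponent G S C → a ∈ C → a ∉ S
  component-avoids (_ , avoids , _) = avoids _

  component-connected : IsComponent G S C → a ∈ C → b ∈ C → Reach G S a b
  component-connected (_ , _ , connected , _) = connected _ _

  component-closed : IsComponent G S C → a ∈ C → Reach G S a b → b ∈ C
  component-closed (_ , _ , _ , closed) = closed _ _

  component-unique : IsComponent G S C → IsComponent G S D → a ∈ C → a ∈ D → C ≡ D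
  component-unique isC isD a∈C a∈D = ⊆-antisym
    (λ b∈C → component-closed isD a∈D (component-connected isC a∈C b∈C))
    (λ b∈D → component-closed isC a∈C (component-connected isD a∈D b∈D))

  component-⊆ : S ⊆ T → IsComponent G T D → IsComponent G S C → a ∈ D → a ∈ C → D ⊆ C
  component-⊆ S⊆T isD isC a∈D a∈C b∈D =
    component-closed isC a∈C (Reach-antitone S⊆T (component-connected isD a∈D b∈D))

  Reach-inside : IsComponent G S C → (∀ {c} → c ∈ C → c ∉ T) → a ∈ C → Reach G S a b → Reach G T a b
  Reach-inside isC C∩T≡⊥ a∈C (here _) = here (C∩T≡⊥ a∈C)
  Reach-inside isC C∩T≡⊥ a∈C r@(step r′ e _) =
    step (Reach-inside isC C∩T≡⊥ a∈C r′) e (C∩T≡⊥ (component-closed isC a∈C r))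

  component-of-larger-cut : S ⊆ T → IsComponent G S C → (∀ {c} → c ∈ C → c ∉ T) → IsComponent G T C
  component-of-larger-cut S⊆T isC@(nonempty , _ , _ , _) C∩T≡⊥ =
    nonempty
    , (λ _ → C∩T≡⊥)
    , (λ _ _ a∈C b∈C → Reach-inside isC C∩T≡⊥ a∈C (component-connected isC a∈C b∈C))
    , (λ _ _ a∈C r → component-closed isC a∈C (Reach-antitone S⊆T r))

  component-∌⇒component-∪ : IsComponent G S C → w ∉ C → IsComponent G (S ∪ ⁅ w ⁆) C
  component-∌⇒component-∪ {w = w} isC w∉C = component-of-larger-cut (p⊆p∪q ⁅ w ⁆) isC λ {c} c∈C →
    x∉p∧x≢y⇒x∉p∪⁅y⁆ (component-avoids isC c∈C) λ { refl → w∉C c∈C }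

  other-component⇒component-∪ : IsComponent G S D → IsComponent G S C → w ∈ C → D ≢ C →
                                IsComponent G (S ∪ ⁅ w ⁆) D
  other-component⇒component-∪ isD isC w∈C D≢C =
    component-∌⇒component-∪ isD λ w∈D → D≢C (component-unique isD isC w∈D w∈C)

  distinct-components⇒Disconnected : IsComponent G S C → IsComponent G S D → C ≢ D → Disconnected G S
  distinct-components⇒Disconnected isC@((a , a∈C) , _) isD@((b , b∈D) , _) C≢D =
    a , b , component-avoids isC a∈C , component-avoids isD b∈D ,
    λ r → C≢D (component-unique isC isD (component-closed isC a∈C r) b∈D)

  unreachable⇒distinct-components : IsComponent G S C → a ∈ C → b ∈ D → ¬ Reach G S a b → C ≢ D
  unreachable⇒distinct-components isC a∈C b∈D ¬r refl = ¬r (component-connected isC a∈C b∈D)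

  components-nonempty : ∀ S → AllComponentsAtLeast G 0 S
  components-nonempty S C ((a , a∈C) , _) = x∈p⇒0<∣p∣ a∈C

  component? : ∀ S C → Dec (IsComponent G S C)
  component? S C = any? (_∈? C)
    ×-dec all? (λ a → a ∈? C →-dec ¬? (a ∈? S))
    ×-dec all? (λ a → all? λ b → a ∈? C →-dec b ∈? C →-dec reach? S a b)
    ×-dec all? (λ a → all? λ b → a ∈? C →-dec reach? S a b →-dec b ∈? C)

  disconnected? : ∀ S → Dec (Disconnected G S)
  disconnected? S = any? λ a → any? λ b → ¬? (a ∈? S) ×-dec ¬? (b ∈? S) ×-dec ¬? (reach? S a b)

  small-component : ¬ AllComponentsAtLeast G g S → ∃[ C ] (IsComponent G S C × ∣ C ∣ ≤ g)
  small-component {g = g} {S = S} ¬big with anySubset? (λ C → component? S C ×-dec ∣ C ∣ ≤? g)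
  ... | yes found = found
  ... | no ¬found = ⊥-elim (¬big λ C isC → ≰⇒> λ C≤g → ¬found (C , isC , C≤g))

  CutVertex⇒R₀-cutset : CutVertex G v → IsRgCutset G 0 ⁅ v ⁆
  CutVertex⇒R₀-cutset {v = v} cut = cut , components-nonempty ⁅ v ⁆

  Cond2a⇔no-singleton-RgCutset : Cond2a G g ⇔ (∀ u → ¬ IsRgCutset G g ⁅ u ⁆)
  Cond2a⇔no-singleton-RgCutset {g = g} = mk⇔ no-singleton cond2a
    where
    no-singleton : Cond2a G g → ∀ u → ¬ IsRgCutset G g ⁅ u ⁆
    no-singleton cond2a u (cut , big) with cond2a u cut
    ... | C , isC , ∣C∣≤g = <⇒≱ (big C isC) ∣C∣≤g
    cond2a : (∀ u → ¬ IsRgCutset G g ⁅ u ⁆) → Cond2a G g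
    cond2a no-singleton u cut = small-component λ big → no-singleton u (cut , big)

  small-component≡⁅w⁆ : AllComponentsAtLeast G g (⁅ v ⁆ ∪ ⁅ w ⁆) →
                        IsComponent G ⁅ v ⁆ C → ∣ C ∣ ≤ g → C ≡ ⁅ w ⁆
  small-component≡⁅w⁆ {g = g} {v = v} {w = w} {C = C} big isC ∣C∣≤g = ⊆-antisym C⊆⁅w⁆ (x∈p⇒⁅x⁆⊆p w∈C)
    where
    w∈C : w ∈ C
    w∈C with w ∈? C
    ... | yes w∈C = w∈C
    ... | no w∉C = ⊥-elim (<⇒≱ (big C (component-∌⇒component-∪ isC w∉C)) ∣C∣≤g)
    C⊆⁅w⁆ : C ⊆ ⁅ w ⁆
    C⊆⁅w⁆ {a} a∈C with a ≟ w
    ... | yes refl = x∈⁅x⁆ a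
    ... | no a≢w = ⊥-elim (<⇒≱ (big Cₐ isCₐ) (≤-trans (<⇒≤ ∣Cₐ∣<∣C∣) ∣C∣≤g))
      where
      a∉T : a ∉ ⁅ v ⁆ ∪ ⁅ w ⁆
      a∉T = x∉p∧x≢y⇒x∉p∪⁅y⁆ (component-avoids isC a∈C) a≢w
      Cₐ : Subset n
      Cₐ = componentOf (⁅ v ⁆ ∪ ⁅ w ⁆) a
      isCₐ : IsComponent G (⁅ v ⁆ ∪ ⁅ w ⁆) Cₐ
      isCₐ = componentOf-isComponent a∉T
      w∉Cₐ : w ∉ Cₐ
      w∉Cₐ w∈Cₐ = Reach-target∉ (∈componentOf⁻ w∈Cₐ) (q⊆p∪q ⁅ v ⁆ ⁅ w ⁆ (x∈⁅x⁆ w))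
      ∣Cₐ∣<∣C∣ : ∣ Cₐ ∣ < ∣ C ∣
      ∣Cₐ∣<∣C∣ = p⊂q⇒∣p∣<∣q∣ (component-⊆ (p⊆p∪q ⁅ w ⁆) isCₐ isC (a∈componentOf a∉T) a∈C , w , w∈C , w∉Cₐ)

  small-component⇒Cond2b : IsRgCutset G g (⁅ v ⁆ ∪ ⁅ w ⁆) → IsComponent G ⁅ v ⁆ C → ∣ C ∣ ≤ g → Cond2b G g
  small-component⇒Cond2b {g = g} {v = v} {w = w} {C = C} ((a , b , a∉T , b∉T , ¬a⇝b) , big) isC ∣C∣≤g =
    inj₁ ( v , distinct-components⇒Disconnected isA isB A≢B
         , C , A , B , isC , isA , isB , ≢-sym A≢C , ≢-sym B≢C , A≢B , ∣C∣≡1 , others)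
    where
    C≡⁅w⁆ : C ≡ ⁅ w ⁆
    C≡⁅w⁆ = small-component≡⁅w⁆ big isC ∣C∣≤g
    w∈C : w ∈ C
    w∈C = subst (w ∈_) (sym C≡⁅w⁆) (x∈⁅x⁆ w)
    ∣C∣≡1 : ∣ C ∣ ≡ 1
    ∣C∣≡1 = trans (cong ∣_∣ C≡⁅w⁆) (∣⁅x⁆∣≡1 w)
    lift : IsComponent G ⁅ v ⁆ D → D ≢ C → IsComponent G (⁅ v ⁆ ∪ ⁅ w ⁆) D
    lift isD = other-component⇒component-∪ isD isC w∈C
    others : ∀ D → IsComponent G ⁅ v ⁆ D → D ≢ C → suc g ≤ ∣ D ∣
    others D isD D≢C = big D (lift isD D≢C)
    ≢C : c ∉ ⁅ v ⁆ ∪ ⁅ w ⁆ → c ∈ D → D ≢ C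
    ≢C {c = c} c∉T c∈D refl = c∉T (q⊆p∪q ⁅ v ⁆ ⁅ w ⁆ (subst (c ∈_) C≡⁅w⁆ c∈D))
    A B : Subset n
    A = componentOf ⁅ v ⁆ a
    B = componentOf ⁅ v ⁆ b
    a∉⁅v⁆ : a ∉ ⁅ v ⁆
    a∉⁅v⁆ = a∉T ∘ p⊆p∪q ⁅ w ⁆
    b∉⁅v⁆ : b ∉ ⁅ v ⁆
    b∉⁅v⁆ = b∉T ∘ p⊆p∪q ⁅ w ⁆
    isA : IsComponent G ⁅ v ⁆ A
    isA = componentOf-isComponent a∉⁅v⁆
    isB : IsComponent G ⁅ v ⁆ B
    isB = componentOf-isComponent b∉⁅v⁆
    A≢C : A ≢ C
    A≢C = ≢C a∉T (a∈componentOf a∉⁅v⁆)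
    B≢C : B ≢ C
    B≢C = ≢C b∉T (a∈componentOf b∉⁅v⁆)
    A≢B : A ≢ B
    A≢B = unreachable⇒distinct-components (lift isA A≢C) (a∈componentOf a∉⁅v⁆) (a∈componentOf b∉⁅v⁆) ¬a⇝b

  pendant⇒RgCutset : IsComponent G ⁅ v ⁆ ⁅ w ⁆ → IsComponent G ⁅ v ⁆ C → IsComponent G ⁅ v ⁆ D →
                     ⁅ w ⁆ ≢ C → ⁅ w ⁆ ≢ D → C ≢ D →
                     (∀ E → IsComponent G ⁅ v ⁆ E → E ≢ ⁅ w ⁆ → suc g ≤ ∣ E ∣) →
                     IsRgCutset G g (⁅ v ⁆ ∪ ⁅ w ⁆)
  pendant⇒RgCutset {v = v} {w = w} {g = g} isW isC isD W≢C W≢D C≢D big =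
    distinct-components⇒Disconnected (lift isC (≢-sym W≢C)) (lift isD (≢-sym W≢D)) C≢D , all
    where
    lift : IsComponent G ⁅ v ⁆ E → E ≢ ⁅ w ⁆ → IsComponent G (⁅ v ⁆ ∪ ⁅ w ⁆) E
    lift isE = other-component⇒component-∪ isE isW (x∈⁅x⁆ w)
    all : AllComponentsAtLeast G g (⁅ v ⁆ ∪ ⁅ w ⁆)
    all E isE@((c , c∈E) , _) = subst (λ F → suc g ≤ ∣ F ∣) F≡E (big F isF F≢W)
      where
      c∉T : c ∉ ⁅ v ⁆ ∪ ⁅ w ⁆
      c∉T = component-avoids isE c∈E
      F : Subset n
      F = componentOf ⁅ v ⁆ c
      isF : IsComponent G ⁅ v ⁆ F
      isF = componentOf-isComponent (c∉T ∘ p⊆p∪q ⁅ w ⁆)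
      c∈F : c ∈ F
      c∈F = a∈componentOf (c∉T ∘ p⊆p∪q ⁅ w ⁆)
      F≢W : F ≢ ⁅ w ⁆
      F≢W F≡W = c∉T (q⊆p∪q ⁅ v ⁆ ⁅ w ⁆ (subst (c ∈_) F≡W c∈F))
      F≡E : F ≡ E
      F≡E = component-unique (lift isF F≢W) isE c∈F c∈E

  Cond2b⇒RgCutset-of-size-2 : Cond2b G g → ∃[ S ] (IsRgCutset G g S × ∣ S ∣ ≡ 2)
  Cond2b⇒RgCutset-of-size-2 (inj₂ (v , w , v≢w , _ , _ , RgS)) = ⁅ v ⁆ ∪ ⁅ w ⁆ , RgS , x≢y⇒∣⁅x⁆∪⁅y⁆∣≡2 v≢w
  Cond2b⇒RgCutset-of-size-2 (inj₁ (v , _ , C₁ , C , D , isC₁ , isC , isD , C₁≢C , C₁≢D , C≢D , ∣C₁∣≡1 , big))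
    with ∣p∣≡1⇒p≡⁅x⁆ C₁ ∣C₁∣≡1
  ... | w , refl = ⁅ v ⁆ ∪ ⁅ w ⁆ , pendant⇒RgCutset isC₁ isC isD C₁≢C C₁≢D C≢D big , x≢y⇒∣⁅x⁆∪⁅y⁆∣≡2 v≢w
    where
    v≢w : v ≢ w
    v≢w refl = component-avoids isC₁ (x∈⁅x⁆ v) (x∈⁅x⁆ v)

  module _ (3≤n : 3 ≤ n) (connected : Connected G) where

    ¬Disconnected-⊥ : ¬ Disconnected G ⊥
    ¬Disconnected-⊥ (a , b , _ , _ , ¬a⇝b) = ¬a⇝b (connected a b)

    Separating⇒≢⊥ : Separating G S → S ≢ ⊥
    Separating⇒≢⊥ (inj₁ disc) refl = ¬Disconnected-⊥ disc
    Separating⇒≢⊥ (inj₂ small) refl = 3≤n⇒n∸k≰1 3≤n (subst (_≤ 1) (sym (∣⊥∣≡0 n)) z≤n) small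

    Separating⁅v⁆⇒CutVertex : Separating G ⁅ v ⁆ → CutVertex G v
    Separating⁅v⁆⇒CutVertex (inj₁ cut) = cut
    Separating⁅v⁆⇒CutVertex {v = v} (inj₂ small) = ⊥-elim (3≤n⇒n∸k≰1 3≤n (≤-reflexive (∣⁅x⁆∣≡1 v)) small)

    CutVertex⇒κ≡1 : CutVertex G v → Kappa≡ G 1
    CutVertex⇒κ≡1 {v = v} cut = (⁅ v ⁆ , inj₁ cut , ∣⁅x⁆∣≡1 v) , λ S sep → p≢⊥⇒0<∣p∣ (Separating⇒≢⊥ sep)

    no-CutVertex⇒κ≡2 : (∀ v → ¬ CutVertex G v) → Disconnected G S → ∣ S ∣ ≡ 2 → Kappa≡ G 2
    no-CutVertex⇒κ≡2 {S = S} no-cut disc ∣S∣≡2 = (S , inj₁ disc , ∣S∣≡2) , λ T sep →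
      p≢⊥∧p≢⁅x⁆⇒1<∣p∣ (Separating⇒≢⊥ sep) λ { v refl → no-cut v (Separating⁅v⁆⇒CutVertex sep) }

    KappaG≡2⇒Cond1⊎Cond2 : KappaG≡ G g 2 → Cond1 G g ⊎ Cond2 G g
    KappaG≡2⇒Cond1⊎Cond2 {g = g} ((S , RgS , ∣S∣≡2) , minimal)
      with ∣p∣≡2⇒p≡⁅x⁆∪⁅y⁆ S ∣S∣≡2 | any? (disconnected? ∘ ⁅_⁆)
    ... | v , w , v≢w , refl | no ¬cut =
      inj₁ (no-CutVertex⇒κ≡2 (λ u cut → ¬cut (u , cut)) (proj₁ RgS) ∣S∣≡2 , v , w , v≢w , RgS)
    ... | v , w , v≢w , refl | yes (u , cut) = inj₂ (CutVertex⇒κ≡1 cut , 0<g , cond2a , cond2b)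
      where
      no-singleton : ∀ u → ¬ IsRgCutset G g ⁅ u ⁆
      no-singleton u Rg = <⇒≱ (minimal ⁅ u ⁆ Rg) (≤-reflexive (∣⁅x⁆∣≡1 u))
      0<g : 0 < g
      0<g = n≢0⇒n>0 λ { refl → no-singleton u (CutVertex⇒R₀-cutset cut) }
      cond2a : Cond2a G g
      cond2a = Equivalence.from Cond2a⇔no-singleton-RgCutset no-singleton
      cond2b : Cond2b G g
      cond2b with disconnected? ⁅ v ⁆ | disconnected? ⁅ w ⁆
      ... | yes cut-v | _ with cond2a v cut-v
      ...   | C , isC , ∣C∣≤g = small-component⇒Cond2b RgS isC ∣C∣≤g
      cond2b | no _ | yes cut-w with cond2a w cut-w
      ...   | C , isC , ∣C∣≤g = small-component⇒Cond2b (subst (IsRgCutset G g) (∪-comm ⁅ v ⁆ ⁅ w ⁆) RgS) isC ∣C∣≤g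
      cond2b | no ¬cut-v | no ¬cut-w = inj₂ (v , w , v≢w , ¬cut-v , ¬cut-w , RgS)

    Cond1⊎Cond2⇒KappaG≡2 : Cond1 G g ⊎ Cond2 G g → KappaG≡ G g 2
    Cond1⊎Cond2⇒KappaG≡2 (inj₁ ((_ , κ-minimal) , v , w , v≢w , RgS)) =
      (⁅ v ⁆ ∪ ⁅ w ⁆ , RgS , x≢y⇒∣⁅x⁆∪⁅y⁆∣≡2 v≢w) , λ S (disc , _) → κ-minimal S (inj₁ disc)
    Cond1⊎Cond2⇒KappaG≡2 (inj₂ (_ , _ , cond2a , cond2b)) = Cond2b⇒RgCutset-of-size-2 cond2b , λ S RgS →
      p≢⊥∧p≢⁅x⁆⇒1<∣p∣ {p = S} (λ { refl → ¬Disconnected-⊥ (proj₁ RgS) })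
        λ { u refl → Equivalence.to Cond2a⇔no-singleton-RgCutset cond2a u RgS }

theorem4p1 : (n g : ℕ) → 3 ≤ n → g ≤ (n ∸ 3) / 2 → (G : Graph n) → Connected G
             → KappaG≡ G g 2 ⇔ (Cond1 G g ⊎ Cond2 G g)
theorem4p1 n g 3≤n _ G connected =
  mk⇔ (KappaG≡2⇒Cond1⊎Cond2 G 3≤n connected) (Cond1⊎Cond2⇒KappaG≡2 G 3≤n connected)
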